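{- Let $G$ be a connected finite simple graph with $|V(G)|\ge 3$. If $\det(G)\ne 1$, then $\tfrac12\det(G)\le \det'(G)\le \det(G)$.
   Context: A vertex set $S$ is a vertex determining set if the only automorphism of $G$ fixing every vertex of $S$ is the identity; $\det(G)$ is the minimum size of such a set. For a graph with at most one isolated vertex and no $K_2$ component, an edge set $T$ is an edge determining set if the only automorphism $\phi$ with $\{\phi(u),\phi(v)\}=\{u,v\}$ for all $\{u,v\}\in T$ is the identity; $\det'(G)$ is the minimum size of such a set. -}

module Defs where

open import Data.Nat using (ℕ; _≤_; _<_)
open import Data.Bool using (Bool; true; false; T)
open import Data.Fin using (Fin; toℕ) renaming (_<_ to _<ᶠ_)
open import Data.Fin.Subset using (Subset; _∈_; ∣_∣)
open import Data.List using (List; []; _∷_; length)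
open import Data.List.Relation.Unary.All using (All)
open import Data.List.Relation.Unary.Unique.Propositional using (Unique)
open import Data.Product using (Σ; _×_; _,_; ∃)
open import Relation.Binary.PropositionalEquality using (_≡_)
open import Relation.Nullary using (¬_)
open import Data.Sum using (_⊎_)
open import Data.Unit using (⊤)

record Graph (n : ℕ) : Set where
  field
    adj   : Fin n → Fin n → Bool
    sym   : ∀ u v → adj u v ≡ adj v u
    irrefl : ∀ v → adj v v ≡ false

open Graph public

Adj : ∀ {n} → Graph n → Fin n → Fin n → Set
Adj G u v = T (adj G u v)

data Walk {n} (G : Graph n) : Fin n → Fin n → Set where
  here : ∀ {v} → Walk G v v
  step : ∀ {u v w} → Adj G u v → Walk G v w → Walk G u w

Connected : ∀ {n} → Graph n → Set
Connected G = ∀ u v → Walk G u v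

record Aut {n} (G : Graph n) : Set where
  field
    f      : Fin n → Fin n
    f⁻¹    : Fin n → Fin n
    inv₁   : ∀ v → f (f⁻¹ v) ≡ v
    inv₂   : ∀ v → f⁻¹ (f v) ≡ v
    pres   : ∀ u v → adj G (f u) (f v) ≡ adj G u v

open Aut public

IsIdentity : ∀ {n} {G : Graph n} → Aut G → Set
IsIdentity φ = ∀ v → f φ v ≡ v

VertexDetermining : ∀ {n} → Graph n → Subset n → Set
VertexDetermining G S =
  (φ : Aut G) → (∀ v → v ∈ S → f φ v ≡ v) → IsIdentity φ

IsDet : ∀ {n} → Graph n → ℕ → Set
IsDet G d =
  (Σ (Subset _) λ S → VertexDetermining G S × ∣ S ∣ ≡ d) ×
  (∀ S → VertexDetermining G S → d ≤ ∣ S ∣)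

record Edge {n} (G : Graph n) : Set where
  constructor edge
  field
    lo hi : Fin n
    lo<hi : lo <ᶠ hi
    isAdj : Adj G lo hi

open Edge public

FixesEdge : ∀ {n} {G : Graph n} → Aut G → Edge G → Set
FixesEdge φ e =
  (f φ (lo e) ≡ lo e × f φ (hi e) ≡ hi e) ⊎ (f φ (lo e) ≡ hi e × f φ (hi e) ≡ lo e)

SameEdge : ∀ {n} {G : Graph n} → Edge G → Edge G → Set
SameEdge e e' = lo e ≡ lo e' × hi e ≡ hi e'

DistinctEdges : ∀ {n} {G : Graph n} → List (Edge G) → Set
DistinctEdges [] = ⊤
DistinctEdges (e ∷ es) = All (λ e' → ¬ SameEdge e e') es × DistinctEdges es

EdgeDetermining : ∀ {n} → (G : Graph n) → List (Edge G) → Set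
EdgeDetermining G Tset =
  (φ : Aut G) → All (FixesEdge φ) Tset → IsIdentity φ

IsDet' : ∀ {n} → Graph n → ℕ → Set
IsDet' G d =
  (Σ (List (Edge G)) λ Tset → DistinctEdges Tset × EdgeDetermining G Tset × length Tset ≡ d) ×
  (∀ Tset → DistinctEdges Tset → EdgeDetermining G Tset → d ≤ length Tset)

module Submission where

open import Defs
open import Data.Nat using (ℕ; _≤_; _*_)
open import Data.Product using (_×_)
open import Relation.Binary.PropositionalEquality using (_≢_)

open import Data.Nat using (zero; suc; _+_; z≤n; s≤s)
open import Data.Nat.Properties
  using (≤-trans; ≤-reflexive; +-monoʳ-≤; n≤1+n; +-suc; *-suc; module ≤-Reasoning)
open import Data.Bool using (true; false; T; T?)
open import Data.Fin using (Fin; zero; suc; punchIn; punchOut)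
open import Data.Fin.Properties
  using (_≟_; any?; suc-injective; <-cmp; punchInᵢ≢i; punchIn-injective; punchIn-punchOut)
open import Data.Fin.Subset using (Subset; _∈_; ∣_∣; _∪_; ⁅_⁆; ⊥)
open import Data.Fin.Subset.Properties using (x∈⁅x⁆; ∣⁅x⁆∣≡1; ∣⊥∣≡0; x∈p∪q⁺)
open import Data.Vec using ([]; _∷_; here; there)
open import Data.List using (List; []; _∷_; length; map; deduplicate)
open import Data.List.Properties using (length-map; length-deduplicate)
open import Data.List.Membership.Propositional using () renaming (_∈_ to _∈ₗ_)
open import Data.List.Membership.Propositional.Properties using (∈-map⁺)
open import Data.List.Relation.Unary.All as All using (All; []; _∷_; reduce; universal)
open import Data.List.Relation.Unary.All.Properties using (all-filter; deduplicate⁻)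
import Data.List.Relation.Unary.All.Properties as Allₚ
open import Data.List.Relation.Unary.AllPairs using (AllPairs; []; _∷_)
import Data.List.Relation.Unary.AllPairs.Properties as AllPairs
open import Data.List.Relation.Unary.Any using (here; there)
open import Data.List.Relation.Unary.Unique.Propositional using (Unique)
import Data.List.Relation.Unary.Unique.Propositional.Properties as Unique
open import Data.Product using (Σ; ∃; _,_; proj₁; proj₂)
open import Data.Sum using (_⊎_; inj₁; inj₂; [_,_])
open import Data.Empty using (⊥-elim)
open import Data.Unit using (tt)
open import Function using (_∘_)
open import Relation.Nullary using (¬_; Dec; yes; no)
open import Relation.Nullary.Decidable using (_×-dec_; _⊎-dec_; ¬?)
open import Relation.Unary using (Decidable)
open import Relation.Binary using (tri<; tri≈; tri>)
import Relation.Binary as B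
open import Relation.Binary.PropositionalEquality
  using (_≡_; refl; trans; cong; cong₂; subst)
import Relation.Binary.PropositionalEquality as ≡

-- Lower bound: the endpoints of an edge determining set form a vertex
-- determining set with at most twice as many vertices.
--
-- Upper bound: let S be a vertex determining set containing distinct r and u
-- (the case S = ∅ is trivial).  For each v ∈ S other than r take the edge from
-- v to a neighbour one step closer to r; an automorphism fixing r and this edge
-- setwise fixes v, since swapping v with its neighbour would change the
-- distance of v to r.  In place of an edge for r take one edge which, together
-- with the edge at u, forces r to be fixed: if u ~ r, any edge from {r, u} to a
-- third vertex (here |V| ≥ 3 and connectivity are used); otherwise the last
-- edge of a shortest path from the neighbour of u to r.  These |S| edges form
-- an edge determining set.

private
  variable
    n : ℕ

∣p∪q∣≤∣p∣+∣q∣ : (p q : Subset n) → ∣ p ∪ q ∣ ≤ ∣ p ∣ + ∣ q ∣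
∣p∪q∣≤∣p∣+∣q∣ [] [] = z≤n
∣p∪q∣≤∣p∣+∣q∣ (true ∷ p) (true ∷ q) =
  s≤s (≤-trans (∣p∪q∣≤∣p∣+∣q∣ p q) (+-monoʳ-≤ ∣ p ∣ (n≤1+n ∣ q ∣)))
∣p∪q∣≤∣p∣+∣q∣ (true ∷ p) (false ∷ q) = s≤s (∣p∪q∣≤∣p∣+∣q∣ p q)
∣p∪q∣≤∣p∣+∣q∣ (false ∷ p) (true ∷ q) =
  ≤-trans (s≤s (∣p∪q∣≤∣p∣+∣q∣ p q)) (≤-reflexive (≡.sym (+-suc ∣ p ∣ ∣ q ∣)))
∣p∪q∣≤∣p∣+∣q∣ (false ∷ p) (false ∷ q) = ∣p∪q∣≤∣p∣+∣q∣ p q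

toList : Subset n → List (Fin n)
toList [] = []
toList (true ∷ p) = zero ∷ map suc (toList p)
toList (false ∷ p) = map suc (toList p)

length-toList : (p : Subset n) → length (toList p) ≡ ∣ p ∣
length-toList [] = refl
length-toList (true ∷ p) = cong suc (trans (length-map suc (toList p)) (length-toList p))
length-toList (false ∷ p) = trans (length-map suc (toList p)) (length-toList p)

∈⇒∈-toList : {p : Subset n} {x : Fin n} → x ∈ p → x ∈ₗ toList p
∈⇒∈-toList {p = true ∷ p} here = here refl
∈⇒∈-toList {p = true ∷ p} (there x∈p) = there (∈-map⁺ suc (∈⇒∈-toList x∈p))
∈⇒∈-toList {p = false ∷ p} (there x∈p) = ∈-map⁺ suc (∈⇒∈-toList x∈p)

toList-unique : (p : Subset n) → Unique (toList p)
toList-unique [] = []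
toList-unique (true ∷ p) =
  Allₚ.map⁺ (universal (λ _ ()) (toList p)) ∷ Unique.map⁺ suc-injective (toList-unique p)
toList-unique (false ∷ p) = Unique.map⁺ suc-injective (toList-unique p)

deduplicate-AllPairs : {A : Set} {R : A → A → Set} (R? : B.Decidable R) (xs : List A) →
                       AllPairs (λ x y → ¬ R x y) (deduplicate R? xs)
deduplicate-AllPairs R? [] = []
deduplicate-AllPairs R? (x ∷ xs) =
  all-filter (¬? ∘ R? x) (deduplicate R? xs) ∷ AllPairs.filter⁺ _ (deduplicate-AllPairs R? xs)

length-reduce : {A B : Set} {P : A → Set} (g : ∀ {x} → P x → B) {xs : List A} (pxs : All P xs) →
                length (reduce g pxs) ≡ length xs
length-reduce g [] = refl
length-reduce g (_ ∷ pxs) = cong suc (length-reduce g pxs)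

first-crossing : {P : ℕ → Set} → Decidable P → ∀ {m} → P m → ¬ P 0 →
                 ∃ λ k → ¬ P k × P (suc k)
first-crossing P? {zero} p ¬p₀ = ⊥-elim (¬p₀ p)
first-crossing P? {suc m} p ¬p₀ with P? m
... | yes q = first-crossing P? q ¬p₀
... | no ¬q = m , ¬q , p

third-vertex : {r u : Fin (suc (suc (suc n)))} → r ≢ u → ∃ λ z → z ≢ r × z ≢ u
third-vertex {r = r} {u} r≢u = punchIn r z' , punchInᵢ≢i r z' , z≢u
  where
    u' = punchOut r≢u
    z' = punchIn u' zero
    z≢u : punchIn r z' ≢ u
    z≢u eq = punchInᵢ≢i u' zero
               (punchIn-injective r z' u' (trans eq (≡.sym (punchIn-punchOut r≢u))))

data Walk≤ (G : Graph n) : Fin n → ℕ → Fin n → Set where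
  stay : ∀ {a k} → Walk≤ G a k a
  move : ∀ {a b c k} → Adj G a b → Walk≤ G b k c → Walk≤ G a (suc k) c

module _ {G : Graph n} where

  adj-sym : (a b : Fin n) → Adj G a b → Adj G b a
  adj-sym a b = subst T (sym G a b)

  adj⇒≢ : {a b : Fin n} → Adj G a b → a ≢ b
  adj⇒≢ {a} x refl = subst T (irrefl G a) x

  toEdge : (a b : Fin n) → Adj G a b → Edge G
  toEdge a b x with <-cmp a b
  ... | tri< a<b _ _ = edge a b a<b x
  ... | tri≈ _ a≡b _ = ⊥-elim (adj⇒≢ x a≡b)
  ... | tri> _ _ b<a = edge b a b<a (adj-sym a b x)

  data FixesPair (ψ : Aut G) (a b : Fin n) : Set where
    fixes : f ψ a ≡ a → f ψ b ≡ b → FixesPair ψ a b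
    swaps : f ψ a ≡ b → f ψ b ≡ a → FixesPair ψ a b

  fixesPair-sym : ∀ {ψ a b} → FixesPair ψ a b → FixesPair ψ b a
  fixesPair-sym (fixes p q) = fixes q p
  fixesPair-sym (swaps p q) = swaps q p

  fixesEdge⇒fixesPair : (ψ : Aut G) (e : Edge G) → FixesEdge ψ e → FixesPair ψ (lo e) (hi e)
  fixesEdge⇒fixesPair ψ e (inj₁ (p , q)) = fixes p q
  fixesEdge⇒fixesPair ψ e (inj₂ (p , q)) = swaps p q

  fixesToEdge⇒fixesPair : (ψ : Aut G) (a b : Fin n) (x : Adj G a b) →
                          FixesEdge ψ (toEdge a b x) → FixesPair ψ a b
  fixesToEdge⇒fixesPair ψ a b x fe with <-cmp a b
  ... | tri< a<b _ _ = fixesEdge⇒fixesPair ψ (edge a b a<b x) fe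
  ... | tri≈ _ a≡b _ = ⊥-elim (adj⇒≢ x a≡b)
  ... | tri> _ _ b<a = fixesPair-sym (fixesEdge⇒fixesPair ψ (edge b a b<a (adj-sym a b x)) fe)

  fixesPair-shared⇒fixed : ∀ {ψ a b c} → FixesPair ψ a b → FixesPair ψ a c → b ≢ c → f ψ a ≡ a
  fixesPair-shared⇒fixed (fixes p _) _ _ = p
  fixesPair-shared⇒fixed (swaps _ _) (fixes p _) _ = p
  fixesPair-shared⇒fixed (swaps p _) (swaps q _) b≢c = ⊥-elim (b≢c (trans (≡.sym p) q))

  fixesPair-fixed⇒fixed : ∀ {ψ a b} → FixesPair ψ a b → f ψ a ≡ a → a ≢ b → f ψ b ≡ b
  fixesPair-fixed⇒fixed (fixes _ q) _ _ = q
  fixesPair-fixed⇒fixed (swaps p _) p' a≢b = ⊥-elim (a≢b (trans (≡.sym p') p))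

  endpoints : List (Edge G) → Subset n
  endpoints [] = ⊥
  endpoints (e ∷ es) = ⁅ lo e ⁆ ∪ (⁅ hi e ⁆ ∪ endpoints es)

  ∣endpoints∣≤2*length : (es : List (Edge G)) → ∣ endpoints es ∣ ≤ 2 * length es
  ∣endpoints∣≤2*length [] = ≤-reflexive (∣⊥∣≡0 n)
  ∣endpoints∣≤2*length (e ∷ es) = begin
    ∣ ⁅ lo e ⁆ ∪ (⁅ hi e ⁆ ∪ endpoints es) ∣         ≤⟨ ∣p∪q∣≤∣p∣+∣q∣ ⁅ lo e ⁆ _ ⟩
    ∣ ⁅ lo e ⁆ ∣ + ∣ ⁅ hi e ⁆ ∪ endpoints es ∣       ≤⟨ +-monoʳ-≤ ∣ ⁅ lo e ⁆ ∣ (∣p∪q∣≤∣p∣+∣q∣ ⁅ hi e ⁆ _) ⟩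
    ∣ ⁅ lo e ⁆ ∣ + (∣ ⁅ hi e ⁆ ∣ + ∣ endpoints es ∣) ≡⟨ cong₂ _+_ (∣⁅x⁆∣≡1 (lo e)) (cong (_+ _) (∣⁅x⁆∣≡1 (hi e))) ⟩
    2 + ∣ endpoints es ∣                            ≤⟨ s≤s (s≤s (∣endpoints∣≤2*length es)) ⟩
    2 + 2 * length es                               ≡⟨ ≡.sym (*-suc 2 (length es)) ⟩
    2 * length (e ∷ es)                             ∎
    where open ≤-Reasoning

  endpoints-determining : (es : List (Edge G)) → EdgeDetermining G es →
                          VertexDetermining G (endpoints es)
  endpoints-determining es determining ψ fixed = determining ψ (fixes-edges es fixed)
    where
      fixes-edges : ∀ es → (∀ v → v ∈ endpoints es → f ψ v ≡ v) → All (FixesEdge ψ) es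
      fixes-edges [] _ = []
      fixes-edges (e ∷ es) fixed =
        inj₁ (fixed (lo e) (x∈p∪q⁺ (inj₁ (x∈⁅x⁆ (lo e)))) ,
              fixed (hi e) (x∈p∪q⁺ (inj₂ (x∈p∪q⁺ (inj₁ (x∈⁅x⁆ (hi e)))))))
        ∷ fixes-edges es (λ v v∈ → fixed v (x∈p∪q⁺ (inj₂ (x∈p∪q⁺ (inj₂ v∈)))))

  det≤2*det' : ∀ {d d'} → IsDet G d → IsDet' G d' → d ≤ 2 * d'
  det≤2*det' (_ , minimal) ((es , _ , determining , refl) , _) =
    ≤-trans (minimal (endpoints es) (endpoints-determining es determining))
            (∣endpoints∣≤2*length es)

  sameEdge? : B.Decidable (SameEdge {G = G})
  sameEdge? e e' = (lo e ≟ lo e') ×-dec (hi e ≟ hi e')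

  fixesEdge-respects-sameEdge : (ψ : Aut G) → FixesEdge ψ B.Respects SameEdge
  fixesEdge-respects-sameEdge ψ {edge _ _ _ _} {edge _ _ _ _} (refl , refl) fe = fe

  distinct-deduplicate : (es : List (Edge G)) → DistinctEdges (deduplicate sameEdge? es)
  distinct-deduplicate es = distinct (deduplicate-AllPairs sameEdge? es)
    where
      distinct : ∀ {es} → AllPairs (λ e e' → ¬ SameEdge e e') es → DistinctEdges es
      distinct [] = tt
      distinct (e∉es ∷ es!) = e∉es , distinct es!

  det'≤length : ∀ {d'} → IsDet' G d' → (es : List (Edge G)) → EdgeDetermining G es →
                d' ≤ length es
  det'≤length (_ , minimal) es determining =
    ≤-trans (minimal (deduplicate sameEdge? es) (distinct-deduplicate es) determining')
            (length-deduplicate sameEdge? es)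
    where
      determining' : EdgeDetermining G (deduplicate sameEdge? es)
      determining' ψ =
        determining ψ ∘ deduplicate⁻ sameEdge? (λ {e} {e'} → fixesEdge-respects-sameEdge ψ {e} {e'}) es

  walk≤-weaken : ∀ {a b k} → Walk≤ G a k b → Walk≤ G a (suc k) b
  walk≤-weaken stay = stay
  walk≤-weaken (move x w) = move x (walk≤-weaken w)

  walk⇒walk≤ : ∀ {a b} → Walk G a b → ∃ λ k → Walk≤ G a k b
  walk⇒walk≤ here = 0 , stay
  walk⇒walk≤ (step x w) = let k , w≤ = walk⇒walk≤ w in suc k , move x w≤

  walk≤? : ∀ k a b → Dec (Walk≤ G a k b)
  walk≤? k a b with a ≟ b
  ... | yes refl = yes stay
  walk≤? zero a b | no a≢b = no λ { stay → a≢b refl }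
  walk≤? (suc k) a b | no a≢b with any? (λ c → T? (adj G a c) ×-dec walk≤? k c b)
  ... | yes (c , x , w) = yes (move x w)
  ... | no ∄c = no λ { stay → a≢b refl ; (move x w) → ∄c (_ , x , w) }

  walk≤-unsnoc : ∀ {a b k} → Walk≤ G a (suc k) b →
                 a ≡ b ⊎ ∃ λ c → Walk≤ G a k c × Adj G c b
  walk≤-unsnoc stay = inj₁ refl
  walk≤-unsnoc {k = zero} (move x stay) = inj₂ (_ , stay , x)
  walk≤-unsnoc {k = suc k} (move x w) with walk≤-unsnoc w
  ... | inj₁ refl = inj₂ (_ , stay , x)
  ... | inj₂ (c , w' , y) = inj₂ (c , move x w' , y)

  aut-walk≤ : (ψ : Aut G) → ∀ {a b a' b' k} → f ψ a ≡ a' → f ψ b ≡ b' →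
              Walk≤ G a k b → Walk≤ G a' k b'
  aut-walk≤ ψ refl refl = map-walk≤
    where
      map-walk≤ : ∀ {a b k} → Walk≤ G a k b → Walk≤ G (f ψ a) k (f ψ b)
      map-walk≤ stay = stay
      map-walk≤ {a} (move {b = b} x w) = move (subst T (≡.sym (pres ψ a b)) x) (map-walk≤ w)

  walk-leaves : {P : Fin n → Set} → Decidable P → ∀ {a b} → Walk G a b → ¬ P a → P b →
                ∃ λ x → ∃ λ y → Adj G x y × ¬ P x × P y
  walk-leaves P? here ¬Pa Pb = ⊥-elim (¬Pa Pb)
  walk-leaves P? {a} (step {v = y} x w) ¬Pa Pb with P? y
  ... | yes Py = a , y , x , ¬Pa , Py
  ... | no ¬Py = walk-leaves P? w ¬Py Pb

  -- v is at distance exactly dist + 1 from r, and next at distance dist.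
  record StepTowards (r v : Fin n) : Set where
    constructor step-towards
    field
      dist         : ℕ
      next         : Fin n
      adjacent     : Adj G v next
      next-reaches : Walk≤ G next dist r
      ¬reaches     : ¬ Walk≤ G v dist r

  open StepTowards

  stepTowards : Connected G → ∀ {r v} → r ≢ v → StepTowards r v
  stepTowards conn {r} {v} r≢v
    with first-crossing (λ k → walk≤? k v r) (proj₂ (walk⇒walk≤ (conn v r))) (λ { stay → r≢v refl })
  ... | k , ¬w , stay = ⊥-elim (¬w stay)
  ... | k , ¬w , move x w = step-towards k _ x w ¬w

  stepEdge : ∀ {r v} → StepTowards r v → Edge G
  stepEdge {v = v} st = toEdge v (next st) (adjacent st)

  stepEdge-fixed : ∀ {r v} (st : StepTowards r v) (ψ : Aut G) → f ψ r ≡ r →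
                   FixesEdge ψ (stepEdge st) → f ψ v ≡ v
  stepEdge-fixed {v = v} st ψ ψr≡r fixes-step
    with fixesToEdge⇒fixesPair ψ v (next st) (adjacent st) fixes-step
  ... | fixes ψv≡v _ = ψv≡v
  ... | swaps _ ψnext≡v = ⊥-elim (¬reaches st (aut-walk≤ ψ ψnext≡v ψr≡r (next-reaches st)))

  outside-neighbour : 3 ≤ n → Connected G → ∀ {r u} → r ≢ u →
                      ∃ λ x → x ≢ r × x ≢ u × (Adj G r x ⊎ Adj G u x)
  outside-neighbour (s≤s (s≤s (s≤s _))) conn {r} {u} r≢u with third-vertex r≢u
  ... | z , z≢r , z≢u
    with walk-leaves (λ v → (v ≟ r) ⊎-dec (v ≟ u)) (conn z r) [ z≢r , z≢u ] (inj₁ refl)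
  ... | x , _ , xr , x∉ , inj₁ refl = x , x∉ ∘ inj₁ , x∉ ∘ inj₂ , inj₁ (adj-sym x r xr)
  ... | x , _ , xu , x∉ , inj₂ refl = x , x∉ ∘ inj₁ , x∉ ∘ inj₂ , inj₂ (adj-sym x u xu)

  root-pinning-edge : 3 ≤ n → Connected G → ∀ {r u} → r ≢ u → (st : StepTowards r u) →
    Σ (Edge G) λ e → ∀ ψ → FixesEdge ψ (stepEdge st) → FixesEdge ψ e → f ψ r ≡ r
  root-pinning-edge n3 conn {r} {u} r≢u (step-towards zero _ ur stay _)
    with outside-neighbour n3 conn r≢u
  ... | x , x≢r , x≢u , inj₁ rx = toEdge r x rx , λ ψ fixes-ur fixes-rx →
    fixesPair-shared⇒fixed (fixesPair-sym (fixesToEdge⇒fixesPair ψ u r ur fixes-ur))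
                           (fixesToEdge⇒fixesPair ψ r x rx fixes-rx) (x≢u ∘ ≡.sym)
  ... | x , x≢r , x≢u , inj₂ ux = toEdge u x ux , λ ψ fixes-ur fixes-ux →
    let ur-fixed = fixesToEdge⇒fixesPair ψ u r ur fixes-ur
        ux-fixed = fixesToEdge⇒fixesPair ψ u x ux fixes-ux
    in fixesPair-fixed⇒fixed ur-fixed
         (fixesPair-shared⇒fixed ur-fixed ux-fixed (x≢r ∘ ≡.sym)) (r≢u ∘ ≡.sym)
  root-pinning-edge n3 conn {r} {u} r≢u (step-towards (suc j) w uw w→r ¬u→r)
    with walk≤-unsnoc w→r
  ... | inj₁ refl = ⊥-elim (¬u→r (move uw stay))
  ... | inj₂ (c , w→c , cr) = toEdge r c rc , λ ψ fixes-uw fixes-rc →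
    pinned ψ (fixesToEdge⇒fixesPair ψ u w uw fixes-uw) (fixesToEdge⇒fixesPair ψ r c rc fixes-rc)
    where
      rc = adj-sym c r cr
      -- Swapping r and c would carry a short walk from u or w to c onto one from u to r.
      pinned : ∀ ψ → FixesPair ψ u w → FixesPair ψ r c → f ψ r ≡ r
      pinned ψ _ (fixes ψr≡r _) = ψr≡r
      pinned ψ (fixes ψu≡u _) (swaps _ ψc≡r) =
        ⊥-elim (¬u→r (aut-walk≤ ψ ψu≡u ψc≡r (move uw w→c)))
      pinned ψ (swaps _ ψw≡u) (swaps _ ψc≡r) =
        ⊥-elim (¬u→r (walk≤-weaken (aut-walk≤ ψ ψw≡u ψc≡r w→c)))

  stepEdges : Connected G → ∀ {r vs} → All (r ≢_) vs → List (Edge G)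
  stepEdges conn = reduce (λ r≢v → stepEdge (stepTowards conn r≢v))

  stepEdges-fixed : (conn : Connected G) → ∀ {r vs} (r≢vs : All (r ≢_) vs) (ψ : Aut G) →
                    f ψ r ≡ r → All (FixesEdge ψ) (stepEdges conn r≢vs) → All (λ v → f ψ v ≡ v) vs
  stepEdges-fixed conn [] ψ ψr≡r [] = []
  stepEdges-fixed conn (r≢v ∷ r≢vs) ψ ψr≡r (fixes-step ∷ fixes-steps) =
    stepEdge-fixed (stepTowards conn r≢v) ψ ψr≡r fixes-step
    ∷ stepEdges-fixed conn r≢vs ψ ψr≡r fixes-steps

  DeterminingList : List (Fin n) → Set
  DeterminingList vs = (ψ : Aut G) → All (λ v → f ψ v ≡ v) vs → IsIdentity ψ

  toList-determining : ∀ {S} → VertexDetermining G S → DeterminingList (toList S)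
  toList-determining determining ψ fixed =
    determining ψ (λ v v∈S → All.lookup fixed (∈⇒∈-toList v∈S))

  determiningList⇒edgeDetermining : 3 ≤ n → Connected G → (vs : List (Fin n)) → Unique vs →
    length vs ≢ 1 → DeterminingList vs →
    Σ (List (Edge G)) λ es → EdgeDetermining G es × length es ≡ length vs
  determiningList⇒edgeDetermining n3 conn [] _ _ determining =
    [] , (λ ψ _ → determining ψ []) , refl
  determiningList⇒edgeDetermining n3 conn (r ∷ []) _ length≢1 _ = ⊥-elim (length≢1 refl)
  determiningList⇒edgeDetermining n3 conn (r ∷ _ ∷ _) (r≢vs@(r≢u ∷ _) ∷ _) _ determining =
    proj₁ pin ∷ stepEdges conn r≢vs , edgeDetermining , cong suc (length-reduce _ r≢vs)
    where
      pin = root-pinning-edge n3 conn r≢u (stepTowards conn r≢u)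
      edgeDetermining : EdgeDetermining G (proj₁ pin ∷ stepEdges conn r≢vs)
      edgeDetermining ψ (fixes-pin ∷ fixes-steps) =
        let ψr≡r = proj₂ pin ψ (All.head fixes-steps) fixes-pin
        in determining ψ (ψr≡r ∷ stepEdges-fixed conn r≢vs ψ ψr≡r fixes-steps)

  det'≤det : ∀ {d d'} → 3 ≤ n → Connected G → IsDet G d → IsDet' G d' → d ≢ 1 → d' ≤ d
  det'≤det n3 conn ((S , determining , refl) , _) isDet' d≢1 =
    let es , edgeDetermining , length-es =
          determiningList⇒edgeDetermining n3 conn (toList S) (toList-unique S)
            (d≢1 ∘ trans (≡.sym (length-toList S))) (toList-determining determining)
    in ≤-trans (det'≤length isDet' es edgeDetermining)
               (≤-reflexive (trans length-es (length-toList S)))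

corollary1 : (n : ℕ) → 3 ≤ n → (G : Graph n) → Connected G →
    (d d' : ℕ) → IsDet G d → IsDet' G d' → d ≢ 1 →
    d ≤ 2 * d' × d' ≤ d
corollary1 n n3 G conn d d' isDet isDet' d≢1 =
  det≤2*det' isDet isDet' , det'≤det n3 conn isDet isDet' d≢1
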